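{- For every integer $n\geq 2$, the number of Fishburn permutations of length $n$ that avoid both classical patterns $321$ and $2134$ equals $n^{2}-3n+4$.
   Context: A permutation of length $n$ is a rearrangement $\pi=\pi_1\cdots\pi_n$ of $[n]$. A permutation $\pi$ contains a classical pattern $p\in S_k$ if some subsequence of $\pi$ of length $k$ is order-isomorphic to $p$; otherwise it avoids $p$. A Fishburn permutation is a permutation $\pi$ for which there are no indices $i<j$ with $\pi_j<\pi_i<\pi_{i+1}$ and $\pi_i=\pi_j+1$. -}

module Defs where

open import Data.Nat using (ℕ; _+_; _*_; _∸_; _≥_)
import Data.Nat as ℕ
open import Data.Fin using (Fin; toℕ; _<_; zero; suc)
open import Data.Vec using (Vec; lookup)
open import Data.Product using (Σ; ∃; _×_; ∃-syntax)
open import Relation.Nullary using (¬_)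
open import Relation.Binary.PropositionalEquality using (_≡_)
open import Function.Bundles using (_⇔_)

IsPerm : {n : ℕ} → Vec (Fin n) n → Set
IsPerm {n} π = ∀ (i j : Fin n) → lookup π i ≡ lookup π j → i ≡ j

Contains : {n k : ℕ} → Vec (Fin n) n → Vec (Fin k) k → Set
Contains {n} {k} π p =
  Σ (Fin k → Fin n) λ e →
    (∀ (a b : Fin k) → a < b → e a < e b) ×
    (∀ (a b : Fin k) → (lookup p a < lookup p b) ⇔ (lookup π (e a) < lookup π (e b)))

Avoids : {n k : ℕ} → Vec (Fin n) n → Vec (Fin k) k → Set
Avoids π p = ¬ Contains π p

Fishburn : {n : ℕ} → Vec (Fin n) n → Set
Fishburn {n} π =
  ¬ (Σ (Fin n) λ i → Σ (Fin n) λ j → Σ (Fin n) λ i' →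
       (toℕ i' ≡ ℕ.suc (toℕ i)) × (i < j) ×
       (lookup π j < lookup π i) × (lookup π i < lookup π i') ×
       (toℕ (lookup π i) ≡ ℕ.suc (toℕ (lookup π j))))

-- The patterns 321 and 2134, 0-indexed.
p321 : Vec (Fin 3) 3
p321 = Data.Vec._∷_ (suc (suc zero)) (Data.Vec._∷_ (suc zero) (Data.Vec._∷_ zero Data.Vec.[]))

p2134 : Vec (Fin 4) 4
p2134 = Data.Vec._∷_ (suc zero) (Data.Vec._∷_ zero (Data.Vec._∷_ (suc (suc zero)) (Data.Vec._∷_ (suc (suc (suc zero))) Data.Vec.[])))

HasCard : {n : ℕ} → (Vec (Fin n) n → Set) → ℕ → Set
HasCard {n} P m =
  Σ (Fin m → Vec (Fin n) n) λ f →
    (∀ i j → f i ≡ f j → i ≡ j) ×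
    (∀ i → P (f i)) ×
    (∀ v → P v → ∃[ i ] f i ≡ v)

FishburnAvoiding : {n : ℕ} → Vec (Fin n) n → Set
FishburnAvoiding π = IsPerm π × Fishburn π × Avoids π p321 × Avoids π p2134

-- Split by the first entry c. If c = 0, deleting it and lowering the other entries is a bijection
-- onto the class one size smaller. If c ≥ 1, the entries below c appear in increasing order (a
-- descent would form a 321 with c), Fishburn-freeness puts one of them right after c, and then the
-- entries above c appear in decreasing order (an ascent would form a 2134 with the first two
-- entries). So at most two entries exceed c: the maximum M at some position k ≥ 2 and possibly
-- c + 1, which must then come last. Such a permutation is determined by c ∈ {M, M − 1, M − 2} and k,
-- giving 1 + (M − 1) + (M − 2) permutations of {0, …, M} with c ≥ 1; so the count grows by 2n − 4
-- from length n − 1 to n, and n² − 3n + 4 follows.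

module Submission where

open import Defs
open import Data.Nat using (ℕ; _+_; _*_; _∸_; _≥_)
open import Data.Nat as ℕ using (zero; suc; _≤_; _<_; z≤n; s≤s; pred; _<?_; _≟_; >-nonZero)
open import Data.Nat.Properties
open import Data.Nat.Tactic.RingSolver
open import Data.Fin as F using (Fin; toℕ; fromℕ<; punchOut; splitAt; join; _↑ˡ_; _↑ʳ_) renaming (zero to fz; suc to fs)
import Data.Fin.Properties as FP
open import Data.Vec using (Vec; []; _∷_; lookup; tabulate; map)
import Data.Vec.Properties as VP
open import Data.Product using (∃; _×_; _,_; proj₁; ∃-syntax)
open import Data.Sum using (_⊎_; inj₁; inj₂)
open import Data.Empty using (⊥; ⊥-elim)
open import Relation.Nullary using (¬_; yes; no)
open import Relation.Binary using (tri<; tri≈; tri>)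
open import Relation.Binary.PropositionalEquality
open import Function.Bundles using (mk⇔; Equivalence)

pred<-≤ : ∀ {x y} → 1 ≤ x → x ≤ y → pred x < y
pred<-≤ (s≤s _) x≤y = x≤y

suc-pred-≥1 : ∀ {x} → 1 ≤ x → suc (pred x) ≡ x
suc-pred-≥1 (s≤s _) = refl

Increasing : ℕ → (ℕ → ℕ) → Set
Increasing k h = ∀ {i} → suc i < k → h i < h (suc i)

module _ {k : ℕ} {h : ℕ → ℕ} (inc : Increasing k h) where

  Increasing⇒< : ∀ {i j} → i < j → j < k → h i < h j
  Increasing⇒< {i} {suc j} i<1+j 1+j<k with m≤n⇒m<n∨m≡n (≤-pred i<1+j)
  ... | inj₁ i<j  = <-trans (Increasing⇒< i<j (<-trans (n<1+n j) 1+j<k)) (inc 1+j<k)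
  ... | inj₂ refl = inc 1+j<k

  Increasing⇒≤ : ∀ {i j} → i ≤ j → j < k → h i ≤ h j
  Increasing⇒≤ i≤j j<k with m≤n⇒m<n∨m≡n i≤j
  ... | inj₁ i<j  = <⇒≤ (Increasing⇒< i<j j<k)
  ... | inj₂ refl = ≤-refl

  Increasing-reflects-< : ∀ {i j} → i < k → h i < h j → i < j
  Increasing-reflects-< {i} {j} i<k hi<hj with i <? j
  ... | yes i<j = i<j
  ... | no  i≮j = ⊥-elim (<⇒≱ hi<hj (Increasing⇒≤ (≮⇒≥ i≮j) i<k))

  Increasing-+ : ∀ i d → i + d < k → h i + d ≤ h (i + d)
  Increasing-+ i zero _ rewrite +-identityʳ i | +-identityʳ (h i) = ≤-refl
  Increasing-+ i (suc d) lt rewrite +-suc i d | +-suc (h i) d =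
    ≤-trans (s≤s (Increasing-+ i d (<-trans (n<1+n _) lt))) (inc lt)

  Increasing-endo⇒id : (∀ {i} → i < k → h i < k) → ∀ {i} → i < k → h i ≡ i
  Increasing-endo⇒id bounded {i} i<k = ≤-antisym (≤-pred (+-cancelʳ-< d (h i) (suc i) upper)) lower
    where
      lower : i ≤ h i
      lower = ≤-trans (m≤n+m i (h 0)) (Increasing-+ 0 i i<k)
      d = k ∸ suc i
      fills : suc i + d ≡ k
      fills = m+[n∸m]≡n i<k
      last : i + d < k
      last = subst (i + d <_) fills ≤-refl
      upper : h i + d < suc i + d
      upper = ≤-<-trans (Increasing-+ i d last) (subst (h (i + d) <_) (sym fills) (bounded last))

-- Permutations as functions on ℕ

-- Positions past the end read as 0.
entry : ∀ {n m} → Vec (Fin n) m → ℕ → ℕ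
entry []       _       = 0
entry (x ∷ xs) zero    = toℕ x
entry (x ∷ xs) (suc p) = entry xs p

entry-lookup : ∀ {n m} (π : Vec (Fin n) m) (i : Fin m) → entry π (toℕ i) ≡ toℕ (lookup π i)
entry-lookup (x ∷ xs) fz     = refl
entry-lookup (x ∷ xs) (fs i) = entry-lookup xs i

entry-fromℕ< : ∀ {n m} (π : Vec (Fin n) m) {p} (p<m : p < m) → entry π p ≡ toℕ (lookup π (fromℕ< p<m))
entry-fromℕ< π p<m = trans (cong (entry π) (sym (FP.toℕ-fromℕ< p<m))) (entry-lookup π (fromℕ< p<m))

entry<n : ∀ {n m} (π : Vec (Fin n) m) {p} → p < m → entry π p < n
entry<n π p<m rewrite entry-fromℕ< π p<m = FP.toℕ<n _

entry-ext : ∀ {n m} (π σ : Vec (Fin n) m) → (∀ p → p < m → entry π p ≡ entry σ p) → π ≡ σ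
entry-ext []       []       _  = refl
entry-ext (x ∷ xs) (y ∷ ys) eq =
  cong₂ _∷_ (FP.toℕ-injective (eq 0 (s≤s z≤n))) (entry-ext xs ys (λ p p<m → eq (suc p) (s≤s p<m)))

clamp : (M x : ℕ) → Fin (suc M)
clamp M       zero    = fz
clamp zero    (suc x) = fz
clamp (suc M) (suc x) = fs (clamp M x)

toℕ-clamp : ∀ M x → x ≤ M → toℕ (clamp M x) ≡ x
toℕ-clamp M       zero    _         = refl
toℕ-clamp (suc M) (suc x) (s≤s x≤M) = cong suc (toℕ-clamp M x x≤M)

fromFunction : (n : ℕ) → (ℕ → ℕ) → Vec (Fin n) n
fromFunction zero    h = []
fromFunction (suc M) h = tabulate (λ i → clamp M (h (toℕ i)))

entry-fromFunction : ∀ n h p → p < n → h p < n → entry (fromFunction n h) p ≡ h p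
entry-fromFunction (suc M) h p p<n hp<n = begin
  entry (fromFunction (suc M) h) p                     ≡⟨ entry-fromℕ< (fromFunction (suc M) h) p<n ⟩
  toℕ (lookup (tabulate (λ i → clamp M (h (toℕ i)))) i) ≡⟨ cong toℕ (VP.lookup∘tabulate (λ j → clamp M (h (toℕ j))) i) ⟩
  toℕ (clamp M (h (toℕ i)))                             ≡⟨ toℕ-clamp M _ (≤-pred (subst (λ q → h q < suc M) (sym toℕi≡p) hp<n)) ⟩
  h (toℕ i)                                             ≡⟨ cong h toℕi≡p ⟩
  h p                                                   ∎
  where
    open ≡-Reasoning
    i = fromℕ< p<n
    toℕi≡p = FP.toℕ-fromℕ< p<n

record FishburnAvoidingOn (n : ℕ) (g : ℕ → ℕ) : Set where
  constructor mkFishburnAvoidingOn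
  field
    injective  : ∀ i j → i < n → j < n → g i ≡ g j → i ≡ j
    fishburn   : ∀ i j → i < j → j < n → g i < g (suc i) → g i ≡ suc (g j) → ⊥
    avoids321  : ∀ i j k → i < j → j < k → k < n → g k < g j → g j < g i → ⊥
    avoids2134 : ∀ i j k l → i < j → j < k → k < l → l < n → g j < g i → g i < g k → g k < g l → ⊥

-- Order-isomorphism is witnessed by increasing maps, so only consecutive comparisons need checking.
contains-by-relabelling : ∀ {n k} (π : Vec (Fin n) n) (p : Vec (Fin (suc k)) (suc k)) (pos val : ℕ → ℕ)
  → Increasing (suc k) pos → pos k < n → Increasing (suc k) val
  → (∀ a → entry π (pos (toℕ a)) ≡ val (toℕ (lookup p a)))
  → Contains π p
contains-by-relabelling {n} {k} π p pos val pos↑ posk<n val↑ matches = e , e↑ , λ a b → mk⇔ (to a b) (from a b)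
  where
    bound : ∀ a → pos (toℕ a) < n
    bound a = ≤-<-trans (Increasing⇒≤ pos↑ (≤-pred (FP.toℕ<n a)) ≤-refl) posk<n
    e : Fin (suc k) → Fin n
    e a = fromℕ< (bound a)
    toℕ-e : ∀ a → toℕ (e a) ≡ pos (toℕ a)
    toℕ-e a = FP.toℕ-fromℕ< (bound a)
    e↑ : ∀ a b → a F.< b → e a F.< e b
    e↑ a b a<b = subst₂ _<_ (sym (toℕ-e a)) (sym (toℕ-e b)) (Increasing⇒< pos↑ a<b (FP.toℕ<n b))
    value : ∀ a → toℕ (lookup π (e a)) ≡ val (toℕ (lookup p a))
    value a = trans (sym (entry-fromℕ< π (bound a))) (matches a)
    to : ∀ a b → lookup p a F.< lookup p b → lookup π (e a) F.< lookup π (e b)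
    to a b lt = subst₂ _<_ (sym (value a)) (sym (value b)) (Increasing⇒< val↑ lt (FP.toℕ<n _))
    from : ∀ a b → lookup π (e a) F.< lookup π (e b) → lookup p a F.< lookup p b
    from a b lt = Increasing-reflects-< val↑ (FP.toℕ<n _) (subst₂ _<_ (value a) (value b) lt)

module _ {n : ℕ} (π : Vec (Fin n) n) where
  private
    value : ∀ {p} (p<n : p < n) → toℕ (lookup π (fromℕ< p<n)) ≡ entry π p
    value p<n = sym (entry-fromℕ< π p<n)

    position : ∀ {p} (p<n : p < n) → toℕ (fromℕ< p<n) ≡ p
    position p<n = FP.toℕ-fromℕ< p<n

    viaEntries : ∀ {k} (p : Vec (Fin k) k) ((e , _ , iso) : Contains π p) a b
      → lookup p a F.< lookup p b → entry π (toℕ (e a)) < entry π (toℕ (e b))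
    viaEntries p (e , _ , iso) a b lt =
      subst₂ _<_ (sym (entry-lookup π (e a))) (sym (entry-lookup π (e b))) (Equivalence.to (iso a b) lt)

  IsPerm⇒injective : IsPerm π → ∀ i j → i < n → j < n → entry π i ≡ entry π j → i ≡ j
  IsPerm⇒injective perm i j i<n j<n eq = begin
    i                 ≡⟨ sym (position i<n) ⟩
    toℕ (fromℕ< i<n)  ≡⟨ cong toℕ (perm _ _ (FP.toℕ-injective (trans (value i<n) (trans eq (sym (value j<n)))))) ⟩
    toℕ (fromℕ< j<n)  ≡⟨ position j<n ⟩
    j                 ∎
    where open ≡-Reasoning

  injective⇒IsPerm : (∀ i j → i < n → j < n → entry π i ≡ entry π j → i ≡ j) → IsPerm π
  injective⇒IsPerm inj a b eq = FP.toℕ-injective (inj (toℕ a) (toℕ b) (FP.toℕ<n a) (FP.toℕ<n b)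
    (trans (entry-lookup π a) (trans (cong toℕ eq) (sym (entry-lookup π b)))))

  Fishburn⇒fishburn : Fishburn π → ∀ i j → i < j → j < n → entry π i < entry π (suc i) → entry π i ≡ suc (entry π j) → ⊥
  Fishburn⇒fishburn fb i j i<j j<n ascent eq = fb (fromℕ< i<n , fromℕ< j<n , fromℕ< 1+i<n ,
      trans (position 1+i<n) (cong suc (sym (position i<n))) ,
      subst₂ _<_ (sym (position i<n)) (sym (position j<n)) i<j ,
      subst₂ _<_ (sym (value j<n)) (sym (value i<n)) (subst (entry π j <_) (sym eq) (n<1+n _)) ,
      subst₂ _<_ (sym (value i<n)) (sym (value 1+i<n)) ascent ,
      trans (value i<n) (trans eq (cong suc (sym (value j<n)))))
    where
      i<n = <-trans i<j j<n
      1+i<n = ≤-trans (s≤s i<j) j<n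

  fishburn⇒Fishburn : (∀ i j → i < j → j < n → entry π i < entry π (suc i) → entry π i ≡ suc (entry π j) → ⊥) → Fishburn π
  fishburn⇒Fishburn fsh (i , j , i′ , i′≡1+i , i<j , _ , ascent , eq) =
    fsh (toℕ i) (toℕ j) i<j (FP.toℕ<n j)
      (subst₂ _<_ (sym (entry-lookup π i)) (trans (sym (entry-lookup π i′)) (cong (entry π) i′≡1+i)) ascent)
      (trans (entry-lookup π i) (trans eq (cong suc (sym (entry-lookup π j)))))

  Avoids321⇒avoids321 : Avoids π p321 → ∀ i j k → i < j → j < k → k < n → entry π k < entry π j → entry π j < entry π i → ⊥
  Avoids321⇒avoids321 av i j k i<j j<k k<n kj ji = av (contains-by-relabelling π p321 pos val pos↑ k<n val↑ matches)
    where
      pos val : ℕ → ℕ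
      pos 0 = i
      pos 1 = j
      pos _ = k
      val 0 = entry π k
      val 1 = entry π j
      val _ = entry π i
      pos↑ : Increasing 3 pos
      pos↑ {0} _ = i<j
      pos↑ {1} _ = j<k
      pos↑ {suc (suc _)} (s≤s (s≤s (s≤s ())))
      val↑ : Increasing 3 val
      val↑ {0} _ = kj
      val↑ {1} _ = ji
      val↑ {suc (suc _)} (s≤s (s≤s (s≤s ())))
      matches : ∀ a → entry π (pos (toℕ a)) ≡ val (toℕ (lookup p321 a))
      matches fz           = refl
      matches (fs fz)      = refl
      matches (fs (fs fz)) = refl

  avoids321⇒Avoids321 : (∀ i j k → i < j → j < k → k < n → entry π k < entry π j → entry π j < entry π i → ⊥)
    → Avoids π p321
  avoids321⇒Avoids321 a3 occ@(e , e↑ , _) =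
    a3 (toℕ (e fz)) (toℕ (e (fs fz))) (toℕ (e (fs (fs fz))))
      (e↑ fz (fs fz) (s≤s z≤n)) (e↑ (fs fz) (fs (fs fz)) (s≤s (s≤s z≤n))) (FP.toℕ<n _)
      (viaEntries p321 occ (fs (fs fz)) (fs fz) (s≤s z≤n)) (viaEntries p321 occ (fs fz) fz (s≤s (s≤s z≤n)))

  Avoids2134⇒avoids2134 : Avoids π p2134 → ∀ i j k l → i < j → j < k → k < l → l < n
    → entry π j < entry π i → entry π i < entry π k → entry π k < entry π l → ⊥
  Avoids2134⇒avoids2134 av i j k l i<j j<k k<l l<n ji ik kl = av (contains-by-relabelling π p2134 pos val pos↑ l<n val↑ matches)
    where
      pos val : ℕ → ℕ
      pos 0 = i
      pos 1 = j
      pos 2 = k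
      pos _ = l
      val 0 = entry π j
      val 1 = entry π i
      val 2 = entry π k
      val _ = entry π l
      pos↑ : Increasing 4 pos
      pos↑ {0} _ = i<j
      pos↑ {1} _ = j<k
      pos↑ {2} _ = k<l
      pos↑ {suc (suc (suc _))} (s≤s (s≤s (s≤s (s≤s ()))))
      val↑ : Increasing 4 val
      val↑ {0} _ = ji
      val↑ {1} _ = ik
      val↑ {2} _ = kl
      val↑ {suc (suc (suc _))} (s≤s (s≤s (s≤s (s≤s ()))))
      matches : ∀ a → entry π (pos (toℕ a)) ≡ val (toℕ (lookup p2134 a))
      matches fz                = refl
      matches (fs fz)           = refl
      matches (fs (fs fz))      = refl
      matches (fs (fs (fs fz))) = refl

  avoids2134⇒Avoids2134 : (∀ i j k l → i < j → j < k → k < l → l < n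
    → entry π j < entry π i → entry π i < entry π k → entry π k < entry π l → ⊥) → Avoids π p2134
  avoids2134⇒Avoids2134 a4 occ@(e , e↑ , _) =
    a4 (toℕ (e fz)) (toℕ (e (fs fz))) (toℕ (e (fs (fs fz)))) (toℕ (e (fs (fs (fs fz)))))
      (e↑ fz (fs fz) (s≤s z≤n)) (e↑ (fs fz) (fs (fs fz)) (s≤s (s≤s z≤n)))
      (e↑ (fs (fs fz)) (fs (fs (fs fz))) (s≤s (s≤s (s≤s z≤n)))) (FP.toℕ<n _)
      (viaEntries p2134 occ (fs fz) fz (s≤s z≤n)) (viaEntries p2134 occ fz (fs (fs fz)) (s≤s (s≤s z≤n)))
      (viaEntries p2134 occ (fs (fs fz)) (fs (fs (fs fz))) (s≤s (s≤s (s≤s z≤n))))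

  FishburnAvoiding⇒On : FishburnAvoiding π → FishburnAvoidingOn n (entry π)
  FishburnAvoiding⇒On (perm , fb , av3 , av4) = mkFishburnAvoidingOn
    (IsPerm⇒injective perm) (Fishburn⇒fishburn fb) (Avoids321⇒avoids321 av3) (Avoids2134⇒avoids2134 av4)

  On⇒FishburnAvoiding : FishburnAvoidingOn n (entry π) → FishburnAvoiding π
  On⇒FishburnAvoiding (mkFishburnAvoidingOn inj fsh a3 a4) =
    injective⇒IsPerm inj , fishburn⇒Fishburn fsh , avoids321⇒Avoids321 a3 , avoids2134⇒Avoids2134 a4

FishburnAvoidingOn-cong : ∀ {n g h} → (∀ p → p < n → g p ≡ h p) → FishburnAvoidingOn n g → FishburnAvoidingOn n h
FishburnAvoidingOn-cong {n} {g} {h} g≗h (mkFishburnAvoidingOn inj fsh a3 a4) =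
  mkFishburnAvoidingOn inj′ fsh′ a3′ a4′
  where
    h≗g : ∀ {p} → p < n → h p ≡ g p
    h≗g p<n = sym (g≗h _ p<n)
    inj′ : ∀ i j → i < n → j < n → h i ≡ h j → i ≡ j
    inj′ i j i<n j<n eq = inj i j i<n j<n (trans (g≗h i i<n) (trans eq (h≗g j<n)))
    fsh′ : ∀ i j → i < j → j < n → h i < h (suc i) → h i ≡ suc (h j) → ⊥
    fsh′ i j i<j j<n ascent eq =
      fsh i j i<j j<n (subst₂ _<_ (h≗g i<n) (h≗g 1+i<n) ascent) (trans (g≗h i i<n) (trans eq (cong suc (h≗g j<n))))
      where
        i<n = <-trans i<j j<n
        1+i<n = ≤-trans (s≤s i<j) j<n
    a3′ : ∀ i j k → i < j → j < k → k < n → h k < h j → h j < h i → ⊥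
    a3′ i j k i<j j<k k<n kj ji = a3 i j k i<j j<k k<n (subst₂ _<_ (h≗g k<n) (h≗g j<n) kj) (subst₂ _<_ (h≗g j<n) (h≗g i<n) ji)
      where
        j<n = <-trans j<k k<n
        i<n = <-trans i<j j<n
    a4′ : ∀ i j k l → i < j → j < k → k < l → l < n → h j < h i → h i < h k → h k < h l → ⊥
    a4′ i j k l i<j j<k k<l l<n ji ik kl =
      a4 i j k l i<j j<k k<l l<n (subst₂ _<_ (h≗g j<n) (h≗g i<n) ji) (subst₂ _<_ (h≗g i<n) (h≗g k<n) ik)
        (subst₂ _<_ (h≗g k<n) (h≗g l<n) kl)
      where
        k<n = <-trans k<l l<n
        j<n = <-trans j<k k<n
        i<n = <-trans i<j j<n

prependZero : (ℕ → ℕ) → ℕ → ℕ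
prependZero g zero    = 0
prependZero g (suc p) = suc (g p)

FishburnAvoidingOn-prependZero : ∀ {n g} → FishburnAvoidingOn n g → FishburnAvoidingOn (suc n) (prependZero g)
FishburnAvoidingOn-prependZero {n} {g} (mkFishburnAvoidingOn inj fsh a3 a4) = mkFishburnAvoidingOn inj′ fsh′ a3′ a4′
  where
    inj′ : ∀ i j → i < suc n → j < suc n → prependZero g i ≡ prependZero g j → i ≡ j
    inj′ zero    zero    _         _         _  = refl
    inj′ (suc i) (suc j) (s≤s i<n) (s≤s j<n) eq = cong suc (inj i j i<n j<n (suc-injective eq))
    fsh′ : ∀ i j → i < j → j < suc n → prependZero g i < prependZero g (suc i) → prependZero g i ≡ suc (prependZero g j) → ⊥
    fsh′ (suc i) (suc j) (s≤s i<j) (s≤s j<n) (s≤s ascent) eq = fsh i j i<j j<n ascent (suc-injective eq)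
    a3′ : ∀ i j k → i < j → j < k → k < suc n → prependZero g k < prependZero g j → prependZero g j < prependZero g i → ⊥
    a3′ (suc i) (suc j) (suc k) (s≤s i<j) (s≤s j<k) (s≤s k<n) (s≤s kj) (s≤s ji) = a3 i j k i<j j<k k<n kj ji
    a4′ : ∀ i j k l → i < j → j < k → k < l → l < suc n
      → prependZero g j < prependZero g i → prependZero g i < prependZero g k → prependZero g k < prependZero g l → ⊥
    a4′ (suc i) (suc j) (suc k) (suc l) (s≤s i<j) (s≤s j<k) (s≤s k<l) (s≤s l<n) (s≤s ji) (s≤s ik) (s≤s kl) =
      a4 i j k l i<j j<k k<l l<n ji ik kl

FishburnAvoidingOn-unprependZero : ∀ {n g} → FishburnAvoidingOn (suc n) (prependZero g) → FishburnAvoidingOn n g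
FishburnAvoidingOn-unprependZero (mkFishburnAvoidingOn inj fsh a3 a4) = mkFishburnAvoidingOn
  (λ i j i<n j<n eq → suc-injective (inj (suc i) (suc j) (s≤s i<n) (s≤s j<n) (cong suc eq)))
  (λ i j i<j j<n ascent eq → fsh (suc i) (suc j) (s≤s i<j) (s≤s j<n) (s≤s ascent) (cong suc eq))
  (λ i j k i<j j<k k<n kj ji → a3 (suc i) (suc j) (suc k) (s≤s i<j) (s≤s j<k) (s≤s k<n) (s≤s kj) (s≤s ji))
  (λ i j k l i<j j<k k<l l<n ji ik kl →
    a4 (suc i) (suc j) (suc k) (suc l) (s≤s i<j) (s≤s j<k) (s≤s k<l) (s≤s l<n) (s≤s ji) (s≤s ik) (s≤s kl))

prepend : ∀ {n} → Vec (Fin n) n → Vec (Fin (suc n)) (suc n)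
prepend σ = fz ∷ map fs σ

entry-map-suc : ∀ {n m} (σ : Vec (Fin n) m) p → p < m → entry (map fs σ) p ≡ suc (entry σ p)
entry-map-suc (x ∷ σ) zero    _         = refl
entry-map-suc (x ∷ σ) (suc p) (s≤s p<m) = entry-map-suc σ p p<m

entry-prepend : ∀ {n} (σ : Vec (Fin n) n) p → p < suc n → prependZero (entry σ) p ≡ entry (prepend σ) p
entry-prepend σ zero    _         = refl
entry-prepend σ (suc p) (s≤s p<n) = sym (entry-map-suc σ p p<n)

prepend-injective : ∀ {n} (u w : Vec (Fin n) n) → prepend u ≡ prepend w → u ≡ w
prepend-injective u w eq = entry-ext u w λ p p<n → suc-injective (begin
  suc (entry u p)               ≡⟨ sym (entry-map-suc u p p<n) ⟩
  entry (prepend u) (suc p)     ≡⟨ cong (λ v → entry v (suc p)) eq ⟩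
  entry (prepend w) (suc p)     ≡⟨ entry-map-suc w p p<n ⟩
  suc (entry w p)               ∎)
  where open ≡-Reasoning

prepend-FishburnAvoiding : ∀ {n} (σ : Vec (Fin n) n) → FishburnAvoiding σ → FishburnAvoiding (prepend σ)
prepend-FishburnAvoiding σ fa = On⇒FishburnAvoiding (prepend σ)
  (FishburnAvoidingOn-cong (entry-prepend σ) (FishburnAvoidingOn-prependZero (FishburnAvoiding⇒On σ fa)))

unprepend : ∀ {n} (π : Vec (Fin (suc n)) (suc n)) → FishburnAvoiding π → entry π 0 ≡ 0
  → ∃ λ σ → FishburnAvoiding σ × prepend σ ≡ π
unprepend {n} π fa π₀≡0 = σ , On⇒FishburnAvoiding σ σ-On , prepend-σ≡π
  where
    fa-On : FishburnAvoidingOn (suc n) (entry π)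
    fa-On = FishburnAvoiding⇒On π fa
    tail : ℕ → ℕ
    tail p = pred (entry π (suc p))
    raised : ∀ p → p < n → entry π (suc p) ≡ suc (tail p)
    raised p p<n with entry π (suc p) in eq
    ... | zero  = ⊥-elim (1+n≢0 (FishburnAvoidingOn.injective fa-On (suc p) 0 (s≤s p<n) (s≤s z≤n) (trans eq (sym π₀≡0))))
    ... | suc _ = refl
    tail<n : ∀ p → p < n → tail p < n
    tail<n p p<n = ≤-pred (subst (_< suc n) (raised p p<n) (entry<n π (s≤s p<n)))
    σ : Vec (Fin n) n
    σ = fromFunction n tail
    entry-σ : ∀ p → p < n → entry σ p ≡ tail p
    entry-σ p p<n = entry-fromFunction n tail p p<n (tail<n p p<n)
    π≗prepend : ∀ p → p < suc n → entry π p ≡ prependZero tail p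
    π≗prepend zero    _         = π₀≡0
    π≗prepend (suc p) (s≤s p<n) = raised p p<n
    σ-On : FishburnAvoidingOn n (entry σ)
    σ-On = FishburnAvoidingOn-cong (λ p p<n → sym (entry-σ p p<n))
             (FishburnAvoidingOn-unprependZero (FishburnAvoidingOn-cong π≗prepend fa-On))
    prepend-σ≡π : prepend σ ≡ π
    prepend-σ≡π = entry-ext (prepend σ) π λ where
      zero    _         → sym π₀≡0
      (suc p) (s≤s p<n) → trans (entry-map-suc σ p p<n) (trans (cong suc (entry-σ p p<n)) (sym (raised p p<n)))

-- Permutations with a positive first entry

belowHead : ℕ → ℕ → ℕ
belowHead k p with suc p <? k
... | yes _ = p
... | no  _ = pred p

belowHead-cases : ∀ k p → (suc p < k × belowHead k p ≡ p) ⊎ (¬ suc p < k × belowHead k p ≡ pred p)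
belowHead-cases k p with suc p <? k
... | yes lt = inj₁ (lt , refl)
... | no  lt = inj₂ (lt , refl)

-- Head c, the maximum M at position k, c + 1 last when c + 2 ≡ M, and the values below c in order elsewhere.
family : ℕ → ℕ → ℕ → ℕ → ℕ
family M c k zero = c
family M c k (suc p) with suc p ≟ k
... | yes _ = M
... | no  _ with 2 + c ≟ M | suc p ≟ M
...   | yes _ | yes _ = pred M
...   | _     | _     = belowHead k p

data FamilyView (M c k p x : ℕ) : Set where
  atMax     : suc p ≡ k → x ≡ M → FamilyView M c k p x
  atLast    : suc p ≡ M → 2 + c ≡ M → suc p ≢ k → x ≡ pred M → FamilyView M c k p x
  beforeMax : suc p ≢ k → ¬ (2 + c ≡ M × suc p ≡ M) → suc p < k → x ≡ p → FamilyView M c k p x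
  afterMax  : suc p ≢ k → ¬ (2 + c ≡ M × suc p ≡ M) → ¬ suc p < k → x ≡ pred p → FamilyView M c k p x

belowHeadView : ∀ {M c k p} → suc p ≢ k → ¬ (2 + c ≡ M × suc p ≡ M) → FamilyView M c k p (belowHead k p)
belowHeadView {k = k} {p} 1+p≢k notLast with belowHead-cases k p
... | inj₁ (lt , eq) = beforeMax 1+p≢k notLast lt eq
... | inj₂ (lt , eq) = afterMax 1+p≢k notLast lt eq

familyView : ∀ M c k p → FamilyView M c k p (family M c k (suc p))
familyView M c k p with suc p ≟ k
... | yes 1+p≡k = atMax 1+p≡k refl
... | no  1+p≢k with 2 + c ≟ M | suc p ≟ M
...   | yes 2+c≡M | yes 1+p≡M = atLast 1+p≡M 2+c≡M 1+p≢k refl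
...   | yes _     | no  1+p≢M = belowHeadView 1+p≢k (λ (_ , 1+p≡M) → 1+p≢M 1+p≡M)
...   | no  2+c≢M | _         = belowHeadView 1+p≢k (λ (2+c≡M , _) → 2+c≢M 2+c≡M)

maxBefore : ∀ {k p} → suc p ≢ k → ¬ suc p < k → k ≤ p
maxBefore 1+p≢k 1+p≮k = ≤-pred (≤∧≢⇒< (≮⇒≥ 1+p≮k) (λ eq → 1+p≢k (sym eq)))

-- k is the position of M; when the head is M, k = M + 1 lies past the end.
data Variant (M c k : ℕ) : Set where
  headIsMax : c ≡ M → k ≡ suc M → Variant M c k
  oneAbove  : suc c ≡ M → 2 ≤ k → k ≤ M → Variant M c k
  twoAbove  : 2 + c ≡ M → 2 ≤ k → k < M → Variant M c k

module _ {M c k : ℕ} where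

  Variant⇒2≤k : 1 ≤ c → Variant M c k → 2 ≤ k
  Variant⇒2≤k 1≤c (headIsMax refl refl) = s≤s 1≤c
  Variant⇒2≤k _   (oneAbove _ 2≤k _)    = 2≤k
  Variant⇒2≤k _   (twoAbove _ 2≤k _)    = 2≤k

  Variant⇒c≤M : Variant M c k → c ≤ M
  Variant⇒c≤M (headIsMax refl _) = ≤-refl
  Variant⇒c≤M (oneAbove refl _ _) = n≤1+n _
  Variant⇒c≤M (twoAbove refl _ _) = ≤-trans (n≤1+n _) (n≤1+n _)

  Variant⇒c<M : Variant M c k → k ≤ M → c < M
  Variant⇒c<M (headIsMax refl refl) k≤M = ⊥-elim (<-irrefl refl k≤M)
  Variant⇒c<M (oneAbove refl _ _)   _   = ≤-refl
  Variant⇒c<M (twoAbove refl _ _)   _   = n≤1+n _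

  Variant⇒k<M : Variant M c k → 2 + c ≡ M → k < M
  Variant⇒k<M (headIsMax refl _) 2+c≡M = ⊥-elim (<-irrefl (sym 2+c≡M) (n≤1+n _))
  Variant⇒k<M (oneAbove refl _ _) 2+c≡M = ⊥-elim (<-irrefl (sym (suc-injective 2+c≡M)) ≤-refl)
  Variant⇒k<M (twoAbove _ _ k<M) _     = k<M

  beforeMax<c : Variant M c k → ∀ {p} → suc p ≤ M → suc p < k → p < c
  beforeMax<c (headIsMax refl _)  1+p≤M _   = 1+p≤M
  beforeMax<c (oneAbove refl _ k≤M) _   1+p<k = ≤-pred (≤-trans 1+p<k k≤M)
  beforeMax<c (twoAbove refl _ k<M) _   1+p<k = ≤-pred (≤-trans 1+p<k (≤-pred k<M))

  afterMax<c : Variant M c k → ∀ {p} → suc p ≤ M → suc p ≢ k → ¬ (2 + c ≡ M × suc p ≡ M) → ¬ suc p < k → pred p < c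
  afterMax<c (headIsMax refl refl) 1+p≤M _ _ 1+p≮k = ⊥-elim (1+p≮k (s≤s 1+p≤M))
  afterMax<c (oneAbove refl 2≤k _) 1+p≤M 1+p≢k _ 1+p≮k =
    pred<-≤ (≤-trans (n≤1+n 1) (≤-trans 2≤k (maxBefore 1+p≢k 1+p≮k))) (≤-pred 1+p≤M)
  afterMax<c (twoAbove refl 2≤k _) 1+p≤M 1+p≢k notLast 1+p≮k =
    pred<-≤ (≤-trans (n≤1+n 1) (≤-trans 2≤k (maxBefore 1+p≢k 1+p≮k)))
      (≤-pred (≤-pred (≤∧≢⇒< 1+p≤M (λ eq → notLast (refl , eq)))))

record Shape (M c k : ℕ) (f : ℕ → ℕ) : Set where
  field
    head             : f 0 ≡ c
    bounded          : ∀ p → p ≤ M → f p ≤ M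
    classify         : ∀ p → 0 < p → p ≤ M →
      (p ≡ k × f p ≡ M × c < M) ⊎ (p ≡ M × f p ≡ suc c × suc c < M × k < M) ⊎ f p < c
    below-increasing : ∀ p q → 0 < p → p < q → q ≤ M → f p < c → f q < c → f p < f q
    second<head      : f 1 < c

family-Shape : ∀ {M c k} → 1 ≤ c → Variant M c k → Shape M c k (family M c k)
family-Shape {M} {c} {k} 1≤c v = record
  { head = refl ; bounded = bounded ; classify = classify ; below-increasing = below-increasing ; second<head = second<head }
  where
    bounded : ∀ p → p ≤ M → family M c k p ≤ M
    bounded zero    _     = Variant⇒c≤M v
    bounded (suc p) 1+p≤M with familyView M c k p
    ... | atMax _ eq         = ≤-reflexive eq
    ... | atLast _ _ _ eq    = ≤-trans (≤-reflexive eq) pred[n]≤n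
    ... | beforeMax _ _ _ eq = ≤-trans (≤-reflexive eq) (≤-trans (n≤1+n p) 1+p≤M)
    ... | afterMax _ _ _ eq  = ≤-trans (≤-reflexive eq) (≤-trans pred[n]≤n (≤-trans (n≤1+n p) 1+p≤M))
    classify : ∀ p → 0 < p → p ≤ M →
      (p ≡ k × family M c k p ≡ M × c < M) ⊎ (p ≡ M × family M c k p ≡ suc c × suc c < M × k < M) ⊎ family M c k p < c
    classify (suc p) _ 1+p≤M with familyView M c k p
    ... | atMax 1+p≡k eq            = inj₁ (1+p≡k , eq , Variant⇒c<M v (subst (_≤ M) 1+p≡k 1+p≤M))
    ... | atLast 1+p≡M 2+c≡M _ eq   = inj₂ (inj₁ (1+p≡M , trans eq (cong pred (sym 2+c≡M)) , ≤-reflexive 2+c≡M , Variant⇒k<M v 2+c≡M))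
    ... | beforeMax _ _ 1+p<k eq    = inj₂ (inj₂ (subst (_< c) (sym eq) (beforeMax<c v 1+p≤M 1+p<k)))
    ... | afterMax 1+p≢k notLast 1+p≮k eq = inj₂ (inj₂ (subst (_< c) (sym eq) (afterMax<c v 1+p≤M 1+p≢k notLast 1+p≮k)))
    below : ∀ p → suc p ≤ M → family M c k (suc p) < c →
      (suc p < k × family M c k (suc p) ≡ p) ⊎ (k ≤ p × family M c k (suc p) ≡ pred p)
    below p _ lt with familyView M c k p
    ... | atMax _ eq                   = ⊥-elim (<⇒≱ lt (subst (c ≤_) (sym eq) (Variant⇒c≤M v)))
    ... | atLast _ 2+c≡M _ eq          = ⊥-elim (<⇒≱ lt (subst (c ≤_) (sym (trans eq (cong pred (sym 2+c≡M)))) (n≤1+n c)))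
    ... | beforeMax _ _ 1+p<k eq       = inj₁ (1+p<k , eq)
    ... | afterMax 1+p≢k _ 1+p≮k eq    = inj₂ (maxBefore 1+p≢k 1+p≮k , eq)
    below-increasing : ∀ p q → 0 < p → p < q → q ≤ M → family M c k p < c → family M c k q < c → family M c k p < family M c k q
    below-increasing (suc p) (suc q) _ (s≤s p<q) 1+q≤M fp<c fq<c
      with below p (≤-trans (s≤s (<⇒≤ p<q)) 1+q≤M) fp<c | below q 1+q≤M fq<c
    ... | inj₁ (_ , eqp)     | inj₁ (_ , eqq)     rewrite eqp | eqq = p<q
    ... | inj₁ (1+p<k , eqp) | inj₂ (k≤q , eqq)   rewrite eqp | eqq = <⇒≤pred (≤-trans 1+p<k k≤q)
    ... | inj₂ (k≤p , _)     | inj₁ (1+q<k , _)   = ⊥-elim (<⇒≱ 1+q<k (≤-trans k≤p (≤-trans (<⇒≤ p<q) (n≤1+n q))))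
    ... | inj₂ (k≤p , eqp)   | inj₂ (_ , eqq)     rewrite eqp | eqq =
      pred-mono-< ⦃ >-nonZero (≤-trans (n≤1+n 1) (≤-trans (Variant⇒2≤k 1≤c v) k≤p)) ⦄ p<q
    second<head : family M c k 1 < c
    second<head with familyView M c k 0
    ... | atMax 1≡k _              = ⊥-elim (<-irrefl 1≡k (Variant⇒2≤k 1≤c v))
    ... | atLast 1≡M 2+c≡M _ _     = ⊥-elim (1+n≢0 (suc-injective (trans 2+c≡M (sym 1≡M))))
    ... | beforeMax _ _ _ eq       = subst (_< c) (sym eq) 1≤c
    ... | afterMax _ _ 1≮k _       = ⊥-elim (1≮k (Variant⇒2≤k 1≤c v))

module _ {M c k : ℕ} {f : ℕ → ℕ} (S : Shape M c k f) where
  open Shape S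

  private
    above : ∀ {i} p → i < p → p ≤ M → c < f p →
      (p ≡ k × f p ≡ M × c < M) ⊎ (p ≡ M × f p ≡ suc c × suc c < M × k < M)
    above p i<p p≤M c<fp with classify p (≤-trans (s≤s z≤n) i<p) p≤M
    ... | inj₁ atK         = inj₁ atK
    ... | inj₂ (inj₁ atM)  = inj₂ atM
    ... | inj₂ (inj₂ fp<c) = ⊥-elim (<-asym c<fp fp<c)

    aboveOrBelow : ∀ {i} p → i < p → p ≤ M → c < f p ⊎ f p < c
    aboveOrBelow p i<p p≤M with classify p (≤-trans (s≤s z≤n) i<p) p≤M
    ... | inj₁ (_ , fp≡M , c<M)            = inj₁ (subst (c <_) (sym fp≡M) c<M)
    ... | inj₂ (inj₁ (_ , fp≡1+c , _ , _)) = inj₁ (subst (c <_) (sym fp≡1+c) (n<1+n c))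
    ... | inj₂ (inj₂ fp<c)                 = inj₂ fp<c

    distinct : ∀ i j → i < j → j ≤ M → f i ≢ f j
    distinct zero j 0<j j≤M eq with aboveOrBelow j 0<j j≤M
    ... | inj₁ c<fj = <-irrefl (trans (sym head) eq) c<fj
    ... | inj₂ fj<c = <-irrefl (trans (sym eq) head) fj<c
    distinct (suc i) j i<j j≤M eq
      with aboveOrBelow (suc i) (s≤s z≤n) (≤-trans (<⇒≤ i<j) j≤M) | aboveOrBelow j i<j j≤M
    ... | inj₂ fi<c | inj₂ fj<c = <-irrefl eq (below-increasing (suc i) j (s≤s z≤n) i<j j≤M fi<c fj<c)
    ... | inj₁ c<fi | inj₂ fj<c = <-asym (subst (_< c) (sym eq) fj<c) c<fi
    ... | inj₂ fi<c | inj₁ c<fj = <-asym (subst (_< c) eq fi<c) c<fj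
    ... | inj₁ c<fi | inj₁ c<fj
      with above (suc i) (s≤s z≤n) (≤-trans (<⇒≤ i<j) j≤M) c<fi | above j i<j j≤M c<fj
    ...   | inj₁ (i≡k , _)                | inj₁ (j≡k , _)                = <-irrefl (trans i≡k (sym j≡k)) i<j
    ...   | inj₁ (_ , fi≡M , _)           | inj₂ (_ , fj≡1+c , 1+c<M , _) = <-irrefl (trans (sym fj≡1+c) (trans (sym eq) fi≡M)) 1+c<M
    ...   | inj₂ (_ , fi≡1+c , 1+c<M , _) | inj₁ (_ , fj≡M , _)           = <-irrefl (trans (sym fi≡1+c) (trans eq fj≡M)) 1+c<M
    ...   | inj₂ (i≡M , _)                | inj₂ (j≡M , _)                = <-irrefl (trans i≡M (sym j≡M)) i<j

  Shape⇒On : FishburnAvoidingOn (suc M) f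
  Shape⇒On = mkFishburnAvoidingOn injective fishburn avoids321 avoids2134
    where
      injective : ∀ i j → i < suc M → j < suc M → f i ≡ f j → i ≡ j
      injective i j (s≤s i≤M) (s≤s j≤M) eq with <-cmp i j
      ... | tri< i<j _ _ = ⊥-elim (distinct i j i<j j≤M eq)
      ... | tri≈ _ i≡j _ = i≡j
      ... | tri> _ _ j<i = ⊥-elim (distinct j i j<i i≤M (sym eq))
      -- a Fishburn ascent f i < f (i+1) can only start at a value below c, and values below c increase
      fishburn : ∀ i j → i < j → j < suc M → f i < f (suc i) → f i ≡ suc (f j) → ⊥
      fishburn zero j _ _ ascent _ = <-asym ascent (subst (f 1 <_) (sym head) second<head)
      fishburn (suc i) j i<j (s≤s j≤M) ascent eq with aboveOrBelow (suc i) (s≤s z≤n) (≤-trans (<⇒≤ i<j) j≤M)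
      ... | inj₂ fi<c = <-asym fj<fi (below-increasing (suc i) j (s≤s z≤n) i<j j≤M fi<c (<-trans fj<fi fi<c))
        where
          fj<fi : f j < f (suc i)
          fj<fi = subst (f j <_) (sym eq) (n<1+n (f j))
      ... | inj₁ c<fi with above (suc i) (s≤s z≤n) (≤-trans (<⇒≤ i<j) j≤M) c<fi
      ...   | inj₁ (_ , fi≡M , _) = <⇒≱ (subst (_< f (suc (suc i))) fi≡M ascent) (bounded (suc (suc i)) (≤-trans i<j j≤M))
      ...   | inj₂ (i≡M , _)      = <⇒≱ i<j (subst (j ≤_) (sym i≡M) j≤M)
      avoids321 : ∀ i j l → i < j → j < l → l < suc M → f l < f j → f j < f i → ⊥
      avoids321 i j l i<j j<l (s≤s l≤M) lj ji with aboveOrBelow j i<j (≤-trans (<⇒≤ j<l) l≤M)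
      ... | inj₂ fj<c = <-asym lj (below-increasing j l (≤-trans (s≤s z≤n) i<j) j<l l≤M fj<c (<-trans lj fj<c))
      ... | inj₁ c<fj with above j i<j (≤-trans (<⇒≤ j<l) l≤M) c<fj
      ...   | inj₁ (_ , fj≡M , _) = <⇒≱ (subst (_< f i) fj≡M ji) (bounded i (≤-trans (<⇒≤ (<-trans i<j j<l)) l≤M))
      ...   | inj₂ (j≡M , _)      = <⇒≱ (subst (_< l) j≡M j<l) l≤M
      avoids2134 : ∀ i j l m → i < j → j < l → l < m → m < suc M → f j < f i → f i < f l → f l < f m → ⊥
      avoids2134 i j l m i<j j<l l<m (s≤s m≤M) ji il lm with aboveOrBelow l (<-trans i<j j<l) (≤-trans (<⇒≤ l<m) m≤M)
      ... | inj₁ c<fl with above l (<-trans i<j j<l) (≤-trans (<⇒≤ l<m) m≤M) c<fl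
      ...   | inj₁ (_ , fl≡M , _) = <⇒≱ (subst (_< f m) fl≡M lm) (bounded m m≤M)
      ...   | inj₂ (l≡M , _)      = <⇒≱ (subst (_< m) l≡M l<m) m≤M
      avoids2134 zero j l m _ _ _ _ _ il _ | inj₂ fl<c = <-asym (subst (_< f l) head il) fl<c
      avoids2134 (suc i) j l m i<j j<l l<m (s≤s m≤M) ji il _ | inj₂ fl<c =
        <-asym ji (below-increasing (suc i) j (s≤s z≤n) i<j (≤-trans (<⇒≤ (<-trans j<l l<m)) m≤M) fi<c (<-trans ji fi<c))
        where
          fi<c = <-trans il fl<c

record Skeleton (M c : ℕ) (g : ℕ → ℕ) (k : ℕ) : Set where
  field
    variant        : Variant M c k
    maxAt          : k ≤ M → g k ≡ M
    lastAt         : 2 + c ≡ M → g M ≡ pred M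
    belowElsewhere : ∀ p → 0 < p → p ≤ M → p ≢ k → ¬ (2 + c ≡ M × p ≡ M) → g p < c

-- The position of the value i < c in the family with maximum at k.
belowPosition : ℕ → ℕ → ℕ
belowPosition k i with suc i <? k
... | yes _ = suc i
... | no  _ = suc (suc i)

belowPosition-cases : ∀ k i → (suc i < k × belowPosition k i ≡ suc i) ⊎ (¬ suc i < k × belowPosition k i ≡ suc (suc i))
belowPosition-cases k i with suc i <? k
... | yes lt = inj₁ (lt , refl)
... | no  lt = inj₂ (lt , refl)

belowPosition≢k : ∀ k i → belowPosition k i ≢ k
belowPosition≢k k i eq with belowPosition-cases k i
... | inj₁ (1+i<k , eq′) = <-irrefl (trans (sym eq′) eq) 1+i<k
... | inj₂ (1+i≮k , eq′) = 1+i≮k (subst (suc i <_) (trans (sym eq′) eq) (n<1+n (suc i)))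

belowPosition≤ : ∀ k i → belowPosition k i ≤ suc (suc i)
belowPosition≤ k i with belowPosition-cases k i
... | inj₁ (_ , eq) = subst (_≤ suc (suc i)) (sym eq) (n≤1+n (suc i))
... | inj₂ (_ , eq) = ≤-reflexive eq

belowPosition-positive : ∀ k i → 0 < belowPosition k i
belowPosition-positive k i with belowPosition-cases k i
... | inj₁ (_ , eq) = subst (0 <_) (sym eq) (s≤s z≤n)
... | inj₂ (_ , eq) = subst (0 <_) (sym eq) (s≤s z≤n)

belowPosition-increasing : ∀ k i j → i < j → belowPosition k i < belowPosition k j
belowPosition-increasing k i j i<j with belowPosition-cases k i | belowPosition-cases k j
... | inj₁ (_ , eqi)     | inj₁ (_ , eqj)     rewrite eqi | eqj = s≤s i<j
... | inj₁ (_ , eqi)     | inj₂ (_ , eqj)     rewrite eqi | eqj = s≤s (≤-trans i<j (n≤1+n j))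
... | inj₂ (1+i≮k , _)   | inj₁ (1+j<k , _)   = ⊥-elim (1+i≮k (<-trans (s≤s i<j) 1+j<k))
... | inj₂ (_ , eqi)     | inj₂ (_ , eqj)     rewrite eqi | eqj = s≤s (s≤s i<j)

belowPosition-beforeMax : ∀ k p → suc p < k → belowPosition k p ≡ suc p
belowPosition-beforeMax k p 1+p<k with belowPosition-cases k p
... | inj₁ (_ , eq)     = eq
... | inj₂ (1+p≮k , _) = ⊥-elim (1+p≮k 1+p<k)

belowPosition-afterMax : ∀ k p → 2 ≤ k → k ≤ p → belowPosition k (pred p) ≡ suc p
belowPosition-afterMax k zero    2≤k k≤0 = ⊥-elim (<⇒≱ 2≤k (≤-trans k≤0 z≤n))
belowPosition-afterMax k (suc p) _   k≤p with belowPosition-cases k p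
... | inj₁ (1+p<k , _) = ⊥-elim (<⇒≱ 1+p<k k≤p)
... | inj₂ (_ , eq)    = eq

roomAfterMax : ∀ {M c k i} → Variant M c k → ¬ suc i < k → i < c → suc (suc i) ≤ M
roomAfterMax (headIsMax refl refl) 1+i≮k i<c = ⊥-elim (1+i≮k (s≤s i<c))
roomAfterMax (oneAbove refl _ _)   _     i<c = s≤s i<c
roomAfterMax (twoAbove refl _ _)   _     i<c = s≤s (s≤s (<⇒≤ i<c))

belowPosition≤M : ∀ {M c k} → Variant M c k → ∀ i → i < c → belowPosition k i ≤ M
belowPosition≤M v i i<c with belowPosition-cases _ i
... | inj₁ (_ , eq)     = subst (_≤ _) (sym eq) (≤-trans i<c (Variant⇒c≤M v))
... | inj₂ (1+i≮k , eq) = subst (_≤ _) (sym eq) (roomAfterMax v 1+i≮k i<c)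

module PositiveHeadShape {M c : ℕ} {g : ℕ → ℕ} (fa : FishburnAvoidingOn (suc M) g)
  (g≤M : ∀ p → p ≤ M → g p ≤ M) (onto : ∀ y → y ≤ M → ∃ λ p → p ≤ M × g p ≡ y)
  (g0≡c : g 0 ≡ c) (1≤c : 1 ≤ c) where

  open FishburnAvoidingOn fa

  c≤M : c ≤ M
  c≤M = subst (_≤ M) g0≡c (g≤M 0 z≤n)

  1≤M : 1 ≤ M
  1≤M = ≤-trans 1≤c c≤M

  -- a descent among later values below c would form a 321 with the head
  below-increasing : ∀ p q → 0 < p → p < q → q ≤ M → g p < c → g q < c → g p < g q
  below-increasing p q 0<p p<q q≤M gp<c gq<c with <-cmp (g p) (g q)
  ... | tri< lt _ _ = lt
  ... | tri≈ _ eq _ = ⊥-elim (<-irrefl (injective p q (≤-trans (s≤s (<⇒≤ p<q)) (s≤s q≤M)) (s≤s q≤M) eq) p<q)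
  ... | tri> _ _ gt = ⊥-elim (avoids321 0 p q 0<p p<q (s≤s q≤M) gt (subst (g p <_) (sym g0≡c) gp<c))

  ≢head : ∀ p → 0 < p → p ≤ M → g p ≢ c
  ≢head (suc p) _ p≤M eq = 1+n≢0 (injective (suc p) 0 (s≤s p≤M) (s≤s z≤n) (trans eq (sym g0≡c)))

  -- otherwise c ∸ 1 occurs later and the head starts a Fishburn pattern
  second<head : g 1 < c
  second<head with <-cmp (g 1) c
  ... | tri< lt _ _ = lt
  ... | tri≈ _ eq _ = ⊥-elim (≢head 1 (s≤s z≤n) 1≤M eq)
  ... | tri> _ _ gt with onto (pred c) (≤-trans pred[n]≤n c≤M)
  ...   | zero  , _   , g0≡c-1 = ⊥-elim (<-irrefl (trans (sym g0≡c-1) g0≡c) (pred<-≤ 1≤c ≤-refl))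
  ...   | suc j , j≤M , gj≡c-1 = ⊥-elim (fishburn 0 (suc j) (s≤s z≤n) (s≤s j≤M) (subst (_< g 1) (sym g0≡c) gt)
                                   (trans g0≡c (trans (sym (suc-pred-≥1 1≤c)) (cong suc (sym gj≡c-1)))))

  above⇒2≤p : ∀ {p} → c < g p → 2 ≤ p
  above⇒2≤p {zero}        c<g0 = ⊥-elim (<-irrefl (sym g0≡c) c<g0)
  above⇒2≤p {suc zero}    c<g1 = ⊥-elim (<-asym c<g1 second<head)
  above⇒2≤p {suc (suc p)} _    = s≤s (s≤s z≤n)

  -- an ascent among values above c would form a 2134 with positions 0 and 1
  above-decreasing : ∀ p q → p < q → q ≤ M → c < g p → c < g q → g q < g p
  above-decreasing p q p<q q≤M c<gp c<gq with <-cmp (g p) (g q)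
  ... | tri> _ _ gt = gt
  ... | tri≈ _ eq _ = ⊥-elim (<-irrefl (injective p q (≤-trans (s≤s (<⇒≤ p<q)) (s≤s q≤M)) (s≤s q≤M) eq) p<q)
  ... | tri< lt _ _ = ⊥-elim (avoids2134 0 1 p q (s≤s z≤n) (above⇒2≤p c<gp) p<q (s≤s q≤M)
                         (subst (g 1 <_) (sym g0≡c) second<head) (subst (_< g p) (sym g0≡c) c<gp) lt)

  above-order : ∀ p q → p ≤ M → c < g p → c < g q → g q < g p → p < q
  above-order p q p≤M c<gp c<gq gq<gp with <-cmp p q
  ... | tri< p<q _ _ = p<q
  ... | tri≈ _ refl _ = ⊥-elim (<-irrefl refl gq<gp)
  ... | tri> _ _ q<p = ⊥-elim (<-asym gq<gp (above-decreasing q p q<p p≤M c<gq c<gp))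

  not-above⇒below : ∀ p → 0 < p → p ≤ M → ¬ c < g p → g p < c
  not-above⇒below p 0<p p≤M c≮gp with <-cmp (g p) c
  ... | tri< lt _ _ = lt
  ... | tri≈ _ eq _ = ⊥-elim (≢head p 0<p p≤M eq)
  ... | tri> _ _ gt = ⊥-elim (c≮gp gt)

  skeleton-headIsMax : c ≡ M → Skeleton M c g (suc M)
  skeleton-headIsMax c≡M = record
    { variant        = headIsMax c≡M refl
    ; maxAt          = λ 1+M≤M → ⊥-elim (<-irrefl refl 1+M≤M)
    ; lastAt         = λ 2+c≡M → ⊥-elim (<-irrefl (trans c≡M (sym 2+c≡M)) (≤-trans (n<1+n c) (n≤1+n _)))
    ; belowElsewhere = λ p 0<p p≤M _ _ → not-above⇒below p 0<p p≤M (λ c<gp → <⇒≱ c<gp (subst (g p ≤_) (sym c≡M) (g≤M p p≤M)))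
    }

  skeleton-oneAbove : suc c ≡ M → ∀ {k} → k ≤ M → g k ≡ M → Skeleton M c g k
  skeleton-oneAbove 1+c≡M {k} k≤M gk≡M = record
    { variant        = oneAbove 1+c≡M (above⇒2≤p (subst (c <_) (sym gk≡M) (≤-reflexive 1+c≡M))) k≤M
    ; maxAt          = λ _ → gk≡M
    ; lastAt         = λ 2+c≡M → ⊥-elim (<-irrefl (sym (suc-injective (trans 2+c≡M (sym 1+c≡M)))) (n<1+n c))
    ; belowElsewhere = λ p 0<p p≤M p≢k _ → not-above⇒below p 0<p p≤M λ c<gp →
        p≢k (injective p k (s≤s p≤M) (s≤s k≤M) (trans (≤-antisym (g≤M p p≤M) (subst (_≤ g p) 1+c≡M c<gp)) (sym gk≡M)))
    }

  -- three values above c would form a 321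
  atMostTwoAbove : ∀ {k} → k ≤ M → g k ≡ M → suc c < M → 2 + c ≡ M
  atMostTwoAbove {k} k≤M gk≡M 1+c<M with 2 + c ≟ M
  ... | yes 2+c≡M = 2+c≡M
  ... | no  2+c≢M with onto (2 + c) 1+c<M | onto (suc c) (<⇒≤ 1+c<M)
  ...   | r , r≤M , gr≡2+c | l , l≤M , gl≡1+c = ⊥-elim (avoids321 k r l k<r r<l (s≤s l≤M) gl<gr gr<gk)
    where
      gr<gk : g r < g k
      gr<gk = subst₂ _<_ (sym gr≡2+c) (sym gk≡M) (≤∧≢⇒< 1+c<M 2+c≢M)
      gl<gr : g l < g r
      gl<gr = subst₂ _<_ (sym gl≡1+c) (sym gr≡2+c) (n<1+n (suc c))
      c<gr : c < g r
      c<gr = subst (c <_) (sym gr≡2+c) (n≤1+n (suc c))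
      k<r : k < r
      k<r = above-order k r k≤M (<-trans c<gr gr<gk) c<gr gr<gk
      r<l : r < l
      r<l = above-order r l r≤M c<gr (subst (c <_) (sym gl≡1+c) (n<1+n c)) gl<gr

  -- otherwise M, c + 1 and the last entry form a 321
  secondLargestLast : 2 + c ≡ M → ∀ {k l} → k ≤ M → g k ≡ M → l ≤ M → g l ≡ suc c → l ≡ M
  secondLargestLast 2+c≡M {k} {l} k≤M gk≡M l≤M gl≡1+c with m≤n⇒m<n∨m≡n l≤M
  ... | inj₂ l≡M = l≡M
  ... | inj₁ l<M = ⊥-elim (avoids321 k l M k<l l<M ≤-refl gM<gl gl<gk)
    where
      gl<gk : g l < g k
      gl<gk = subst₂ _<_ (sym gl≡1+c) (sym gk≡M) (≤-reflexive 2+c≡M)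
      c<gl : c < g l
      c<gl = subst (c <_) (sym gl≡1+c) (n<1+n c)
      k<l : k < l
      k<l = above-order k l k≤M (<-trans c<gl gl<gk) c<gl gl<gk
      gM≢M : g M ≢ M
      gM≢M eq = <-irrefl (sym (injective M k ≤-refl (s≤s k≤M) (trans eq (sym gk≡M)))) (<-trans k<l l<M)
      gM≢1+c : g M ≢ suc c
      gM≢1+c eq = <-irrefl (sym (injective M l ≤-refl (s≤s l≤M) (trans eq (sym gl≡1+c)))) l<M
      gM<gl : g M < g l
      gM<gl = subst (g M <_) (sym gl≡1+c)
        (≤∧≢⇒< (≤-pred (≤∧≢⇒< (subst (g M ≤_) (sym 2+c≡M) (g≤M M ≤-refl)) (λ eq → gM≢M (trans eq 2+c≡M)))) gM≢1+c)

  skeleton-twoAbove : 2 + c ≡ M → ∀ {k l} → k ≤ M → g k ≡ M → l ≤ M → g l ≡ suc c → Skeleton M c g k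
  skeleton-twoAbove 2+c≡M {k} {l} k≤M gk≡M l≤M gl≡1+c = record
    { variant        = twoAbove 2+c≡M (above⇒2≤p (<-trans c<gl gl<gk)) (<-≤-trans k<l l≤M)
    ; maxAt          = λ _ → gk≡M
    ; lastAt         = λ _ → trans (cong g (sym l≡M)) (trans gl≡1+c (cong pred 2+c≡M))
    ; belowElsewhere = λ p 0<p p≤M p≢k notLast → not-above⇒below p 0<p p≤M (elsewhere p p≤M p≢k notLast)
    }
    where
      l≡M : l ≡ M
      l≡M = secondLargestLast 2+c≡M k≤M gk≡M l≤M gl≡1+c
      gl<gk : g l < g k
      gl<gk = subst₂ _<_ (sym gl≡1+c) (sym gk≡M) (≤-reflexive 2+c≡M)
      c<gl : c < g l
      c<gl = subst (c <_) (sym gl≡1+c) (n<1+n c)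
      k<l : k < l
      k<l = above-order k l k≤M (<-trans c<gl gl<gk) c<gl gl<gk
      elsewhere : ∀ p → p ≤ M → p ≢ k → ¬ (2 + c ≡ M × p ≡ M) → ¬ c < g p
      elsewhere p p≤M p≢k notLast c<gp with m≤n⇒m<n∨m≡n c<gp
      ... | inj₂ 1+c≡gp = notLast (2+c≡M , trans (injective p l (s≤s p≤M) (s≤s l≤M) (trans (sym 1+c≡gp) (sym gl≡1+c))) l≡M)
      ... | inj₁ 1+c<gp = p≢k (injective p k (s≤s p≤M) (s≤s k≤M)
              (trans (≤-antisym (subst (g p ≤_) (sym 2+c≡M) (g≤M p p≤M)) 1+c<gp) (trans 2+c≡M (sym gk≡M))))

  skeleton : ∃ (Skeleton M c g)
  skeleton with m≤n⇒m<n∨m≡n c≤M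
  ... | inj₂ c≡M = suc M , skeleton-headIsMax c≡M
  ... | inj₁ c<M with onto M ≤-refl
  ...   | k , k≤M , gk≡M with suc c ≟ M
  ...     | yes 1+c≡M = k , skeleton-oneAbove 1+c≡M k≤M gk≡M
  ...     | no  1+c≢M with onto (suc c) c<M
  ...       | l , l≤M , gl≡1+c = k , skeleton-twoAbove (atMostTwoAbove k≤M gk≡M (≤∧≢⇒< c<M 1+c≢M)) k≤M gk≡M l≤M gl≡1+c

  -- the values below c fill the remaining positions increasingly, so they are forced
  Skeleton⇒family : ∀ {k} → Skeleton M c g k → ∀ p → p ≤ M → g p ≡ family M c k p
  Skeleton⇒family {k} sk = agree
    where
      open Skeleton sk
      h : ℕ → ℕ
      h i = g (belowPosition k i)
      h<c : ∀ {i} → i < c → h i < c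
      h<c {i} i<c = belowElsewhere (belowPosition k i) (belowPosition-positive k i) (belowPosition≤M variant i i<c) (belowPosition≢k k i)
        λ (2+c≡M , pos≡M) → <⇒≱ (s≤s (s≤s i<c)) (subst (_≤ suc (suc i)) (trans pos≡M (sym 2+c≡M)) (belowPosition≤ k i))
      h-increasing : Increasing c h
      h-increasing {i} 1+i<c = below-increasing (belowPosition k i) (belowPosition k (suc i)) (belowPosition-positive k i)
        (belowPosition-increasing k i (suc i) (n<1+n i)) (belowPosition≤M variant (suc i) 1+i<c) (h<c (<-trans (n<1+n i) 1+i<c)) (h<c 1+i<c)
      h≗id : ∀ {i} → i < c → h i ≡ i
      h≗id = Increasing-endo⇒id h-increasing h<c
      agree : ∀ p → p ≤ M → g p ≡ family M c k p
      agree zero    _ = g0≡c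
      agree (suc p) 1+p≤M with familyView M c k p
      ... | atMax 1+p≡k eq = trans (cong g 1+p≡k) (trans (maxAt (subst (_≤ M) 1+p≡k 1+p≤M)) (sym eq))
      ... | atLast 1+p≡M 2+c≡M _ eq = trans (cong g 1+p≡M) (trans (lastAt 2+c≡M) (sym eq))
      ... | beforeMax _ _ 1+p<k eq = begin
        g (suc p)                  ≡⟨ cong g (sym (belowPosition-beforeMax k p 1+p<k)) ⟩
        h p                        ≡⟨ h≗id (beforeMax<c variant 1+p≤M 1+p<k) ⟩
        p                          ≡⟨ sym eq ⟩
        family M c k (suc p)       ∎
        where open ≡-Reasoning
      ... | afterMax 1+p≢k notLast 1+p≮k eq = begin
        g (suc p)                  ≡⟨ cong g (sym (belowPosition-afterMax k p (Variant⇒2≤k 1≤c variant) (maxBefore 1+p≢k 1+p≮k))) ⟩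
        h (pred p)                 ≡⟨ h≗id (afterMax<c variant 1+p≤M 1+p≢k notLast 1+p≮k) ⟩
        pred p                     ≡⟨ sym eq ⟩
        family M c k (suc p)       ∎
        where open ≡-Reasoning

  ≗family : ∃ λ k → Variant M c k × (∀ p → p ≤ M → g p ≡ family M c k p)
  ≗family = let (k , sk) = skeleton in k , Skeleton.variant sk , Skeleton⇒family sk

injective⇒surjective : ∀ {n} (f : Fin n → Fin n) → (∀ i j → f i ≡ f j → i ≡ j) → ∀ y → ∃ λ i → f i ≡ y
injective⇒surjective {suc m} f injective y with FP.any? (λ i → f i F.≟ y)
... | yes hit = hit
... | no  miss with FP.pigeonhole (n<1+n m) (λ i → punchOut {i = y} (λ eq → miss (i , sym eq)))
...   | i , j , i<j , eq = ⊥-elim (<-irrefl (cong toℕ (injective i j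
          (FP.punchOut-injective {i = y} (λ eq → miss (i , sym eq)) (λ eq → miss (j , sym eq)) eq))) i<j)

IsPerm⇒onto : ∀ {n} (π : Vec (Fin n) n) → IsPerm π → ∀ y → y < n → ∃ λ p → p < n × entry π p ≡ y
IsPerm⇒onto π perm y y<n with injective⇒surjective (lookup π) perm (fromℕ< y<n)
... | i , πi≡y = toℕ i , FP.toℕ<n i , trans (entry-lookup π i) (trans (cong toℕ πi≡y) (FP.toℕ-fromℕ< y<n))

familyPerm : (M c k : ℕ) → Vec (Fin (suc M)) (suc M)
familyPerm M c k = fromFunction (suc M) (family M c k)

module _ {M c k : ℕ} (1≤c : 1 ≤ c) (v : Variant M c k) where

  entry-familyPerm : ∀ p → p ≤ M → entry (familyPerm M c k) p ≡ family M c k p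
  entry-familyPerm p p≤M = entry-fromFunction (suc M) (family M c k) p (s≤s p≤M) (s≤s (Shape.bounded (family-Shape 1≤c v) p p≤M))

  familyPerm-FishburnAvoiding : FishburnAvoiding (familyPerm M c k)
  familyPerm-FishburnAvoiding = On⇒FishburnAvoiding (familyPerm M c k)
    (FishburnAvoidingOn-cong (λ p p<1+M → sym (entry-familyPerm p (≤-pred p<1+M))) (Shape⇒On (family-Shape 1≤c v)))

  familyPerm-head : entry (familyPerm M c k) 0 ≡ c
  familyPerm-head = entry-familyPerm 0 z≤n

familyPerm-complete : ∀ {M} (π : Vec (Fin (suc M)) (suc M)) → FishburnAvoiding π → 1 ≤ entry π 0
  → ∃ λ k → Variant M (entry π 0) k × π ≡ familyPerm M (entry π 0) k
familyPerm-complete {M} π fa 1≤c with PositiveHeadShape.≗family (FishburnAvoiding⇒On π fa)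
  (λ p p≤M → ≤-pred (entry<n π (s≤s p≤M))) onto refl 1≤c
  where
    onto : ∀ y → y ≤ M → ∃ λ p → p ≤ M × entry π p ≡ y
    onto y y≤M = let (p , p<1+M , πp≡y) = IsPerm⇒onto π (proj₁ fa) y (s≤s y≤M) in p , ≤-pred p<1+M , πp≡y
... | k , v , π≗family = k , v , entry-ext π (familyPerm M (entry π 0) k)
  λ p p<1+M → trans (π≗family p (≤-pred p<1+M)) (sym (entry-familyPerm 1≤c v p (≤-pred p<1+M)))

family-atMax : ∀ M c k → 1 ≤ k → family M c k k ≡ M
family-atMax M c (suc k) _ with familyView M c (suc k) k
... | atMax _ eq             = eq
... | atLast _ _ k≢k _       = ⊥-elim (k≢k refl)
... | beforeMax k≢k _ _ _    = ⊥-elim (k≢k refl)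
... | afterMax k≢k _ _ _     = ⊥-elim (k≢k refl)

family-max-unique : ∀ {M c k k′} → 1 ≤ c → Variant M c k′ → 1 ≤ k → k ≤ M → family M c k′ k ≡ M → k ≡ k′
family-max-unique {M} {c} {k} {k′} 1≤c v′ 1≤k k≤M atk≡M with Shape.classify (family-Shape 1≤c v′) k 1≤k k≤M
... | inj₁ (k≡k′ , _)                        = k≡k′
... | inj₂ (inj₁ (_ , atk≡1+c , 1+c<M , _)) = ⊥-elim (<-irrefl (trans (sym atk≡1+c) atk≡M) 1+c<M)
... | inj₂ (inj₂ atk<c)                      = ⊥-elim (<⇒≱ atk<c (subst (c ≤_) (sym atk≡M) (Variant⇒c≤M v′)))

familyPerm-max-unique : ∀ {M c k k′} → 1 ≤ c → Variant M c k → Variant M c k′ → 2 ≤ k → k ≤ M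
  → familyPerm M c k ≡ familyPerm M c k′ → k ≡ k′
familyPerm-max-unique {M} {c} {k} {k′} 1≤c v v′ 2≤k k≤M eq = family-max-unique 1≤c v′ 1≤k k≤M (begin
  family M c k′ k                ≡⟨ sym (entry-familyPerm 1≤c v′ k k≤M) ⟩
  entry (familyPerm M c k′) k    ≡⟨ cong (λ π → entry π k) (sym eq) ⟩
  entry (familyPerm M c k) k     ≡⟨ entry-familyPerm 1≤c v k k≤M ⟩
  family M c k k                 ≡⟨ family-atMax M c k 1≤k ⟩
  M                              ∎)
  where
    open ≡-Reasoning
    1≤k = ≤-trans (n≤1+n 1) 2≤k

familyPerm-injective : ∀ {M c k k′} → 1 ≤ c → Variant M c k → Variant M c k′
  → familyPerm M c k ≡ familyPerm M c k′ → k ≡ k′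
familyPerm-injective _ (headIsMax _ k≡1+M) (headIsMax _ k′≡1+M) _ = trans k≡1+M (sym k′≡1+M)
familyPerm-injective _ (headIsMax c≡M _) (oneAbove 1+c≡M _ _) _ =
  ⊥-elim (<-irrefl (trans c≡M (sym 1+c≡M)) (n<1+n _))
familyPerm-injective _ (headIsMax c≡M _) (twoAbove 2+c≡M _ _) _ =
  ⊥-elim (<-irrefl (trans c≡M (sym 2+c≡M)) (≤-trans (n<1+n _) (n≤1+n _)))
familyPerm-injective 1≤c v@(oneAbove _ 2≤k k≤M) v′ = familyPerm-max-unique 1≤c v v′ 2≤k k≤M
familyPerm-injective 1≤c v@(twoAbove _ 2≤k k<M) v′ = familyPerm-max-unique 1≤c v v′ 2≤k (<⇒≤ k<M)

-- Counting

HasCard-empty : ∀ {n} {P : Vec (Fin n) n → Set} → (∀ v → ¬ P v) → HasCard P 0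
HasCard-empty ¬P = (λ ()) , (λ ()) , (λ ()) , λ v pv → ⊥-elim (¬P v pv)

HasCard-⊎ : ∀ {n} {P Q R : Vec (Fin n) n → Set} {a b}
  → HasCard Q a → HasCard R b → (∀ v → Q v → ¬ R v)
  → (∀ v → P v → Q v ⊎ R v) → (∀ v → Q v ⊎ R v → P v)
  → HasCard P (a + b)
HasCard-⊎ {n} {P} {Q} {R} {a} {b} (fQ , injQ , inQ , ontoQ) (fR , injR , inR , ontoR) disjoint split merge =
  f , injective , member , onto
  where
    g : Fin a ⊎ Fin b → Vec (Fin n) n
    g (inj₁ x) = fQ x
    g (inj₂ y) = fR y
    f : Fin (a + b) → Vec (Fin n) n
    f i = g (splitAt a i)
    g-injective : ∀ x y → g x ≡ g y → x ≡ y
    g-injective (inj₁ x) (inj₁ y) eq = cong inj₁ (injQ x y eq)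
    g-injective (inj₂ x) (inj₂ y) eq = cong inj₂ (injR x y eq)
    g-injective (inj₁ x) (inj₂ y) eq = ⊥-elim (disjoint (fR y) (subst Q eq (inQ x)) (inR y))
    g-injective (inj₂ x) (inj₁ y) eq = ⊥-elim (disjoint (fQ y) (inQ y) (subst R eq (inR x)))
    injective : ∀ i j → f i ≡ f j → i ≡ j
    injective i j eq = begin
      i                      ≡⟨ sym (FP.join-splitAt a b i) ⟩
      join a b (splitAt a i) ≡⟨ cong (join a b) (g-injective (splitAt a i) (splitAt a j) eq) ⟩
      join a b (splitAt a j) ≡⟨ FP.join-splitAt a b j ⟩
      j                      ∎
      where open ≡-Reasoning
    member : ∀ i → P (f i)
    member i with splitAt a i
    ... | inj₁ x = merge _ (inj₁ (inQ x))
    ... | inj₂ y = merge _ (inj₂ (inR y))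
    onto : ∀ v → P v → ∃[ i ] f i ≡ v
    onto v pv with split v pv
    ... | inj₁ q = let (x , fx≡v) = ontoQ v q in x ↑ˡ b , trans (cong g (FP.splitAt-↑ˡ a x b)) fx≡v
    ... | inj₂ r = let (y , fy≡v) = ontoR v r in a ↑ʳ y , trans (cong g (FP.splitAt-↑ʳ a b y)) fy≡v

HasCard-image : ∀ {n m} {P : Vec (Fin n) n → Set} {Q : Vec (Fin m) m → Set} {a}
  (e : Vec (Fin n) n → Vec (Fin m) m) → (∀ u w → e u ≡ e w → u ≡ w)
  → (∀ u → P u → Q (e u)) → (∀ w → Q w → ∃ λ u → P u × e u ≡ w)
  → HasCard P a → HasCard Q a
HasCard-image e e-injective PQ QP (f , injective , member , onto) =
  (λ i → e (f i)) , (λ i j eq → injective i j (e-injective _ _ eq)) , (λ i → PQ _ (member i)) ,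
  λ w qw → let (u , pu , eu≡w) = QP w qw ; (i , fi≡u) = onto u pu in i , trans (cong e fi≡u) eu≡w

-- t counts the values above the (positive) first entry.
HeadGap : ∀ M → ℕ → Vec (Fin (suc M)) (suc M) → Set
HeadGap M t π = FishburnAvoiding π × 1 ≤ entry π 0 × t + entry π 0 ≡ M

HeadGap-empty : ∀ {M t} → M ≤ t → HasCard (HeadGap M t) 0
HeadGap-empty {M} {t} M≤t = HasCard-empty λ π (_ , 1≤c , t+c≡M) →
  <⇒≱ (subst (t <_) t+c≡M (m<m+n t 1≤c)) M≤t

HeadGap-count : ∀ {M t c d} → t + c ≡ M → 1 ≤ c → (κ : Fin d → ℕ) → (∀ i j → κ i ≡ κ j → i ≡ j)
  → (∀ i → Variant M c (κ i)) → (∀ {k} → Variant M c k → ∃ λ i → κ i ≡ k) → HasCard (HeadGap M t) d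
HeadGap-count {M} {t} {c} {d} t+c≡M 1≤c κ κ-injective κ-variant κ-onto = f , injective , member , onto
  where
    f : Fin d → Vec (Fin (suc M)) (suc M)
    f i = familyPerm M c (κ i)
    injective : ∀ i j → f i ≡ f j → i ≡ j
    injective i j eq = κ-injective i j (familyPerm-injective 1≤c (κ-variant i) (κ-variant j) eq)
    member : ∀ i → HeadGap M t (f i)
    member i = familyPerm-FishburnAvoiding 1≤c (κ-variant i) ,
      subst (1 ≤_) (sym (familyPerm-head 1≤c (κ-variant i))) 1≤c ,
      trans (cong (t +_) (familyPerm-head 1≤c (κ-variant i))) t+c≡M
    onto : ∀ π → HeadGap M t π → ∃ λ i → f i ≡ π
    onto π (fa , 1≤π₀ , t+π₀≡M)
      with entry π 0 | +-cancelˡ-≡ t _ _ (trans t+π₀≡M (sym t+c≡M)) | familyPerm-complete π fa 1≤π₀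
    ... | _ | refl | k , v , π≡family = let (i , κi≡k) = κ-onto v in i , trans (cong (familyPerm M c) κi≡k) (sym π≡family)

HeadGap0-count : ∀ M → 1 ≤ M → HasCard (HeadGap M 0) 1
HeadGap0-count M 1≤M = HeadGap-count refl 1≤M (λ _ → suc M) (λ { fz fz _ → refl ; fz (fs ()) _ ; (fs ()) _ _ })
  (λ _ → headIsMax refl refl) onto
  where
    onto : ∀ {k} → Variant M M k → ∃ λ i → suc M ≡ k
    onto (headIsMax _ k≡1+M)  = fz , sym k≡1+M
    onto (oneAbove 1+M≡M _ _) = ⊥-elim (<-irrefl (sym 1+M≡M) (n<1+n M))
    onto (twoAbove 2+M≡M _ _) = ⊥-elim (<-irrefl (sym 2+M≡M) (≤-trans (n<1+n M) (n≤1+n _)))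

-- With t ∈ {1, 2} values above the head c, the maximum may sit at any of the positions 2, …, c + 1.
fromMaxPosition : ∀ {c k} → 2 ≤ k → k ≤ suc c → ∃ λ (i : Fin c) → 2 + toℕ i ≡ k
fromMaxPosition {c} {suc (suc k)} (s≤s (s≤s _)) (s≤s k<c) = fromℕ< k<c , cong (2 +_) (FP.toℕ-fromℕ< k<c)

maxPosition-injective : ∀ {c} (i j : Fin c) → 2 + toℕ i ≡ 2 + toℕ j → i ≡ j
maxPosition-injective i j eq = FP.toℕ-injective (suc-injective (suc-injective eq))

HeadGap1-count : ∀ c → HasCard (HeadGap (1 + c) 1) c
HeadGap1-count zero    = HeadGap-empty ≤-refl
HeadGap1-count (suc c) = HeadGap-count refl (s≤s z≤n) (λ i → 2 + toℕ i) maxPosition-injective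
  (λ i → oneAbove refl (s≤s (s≤s z≤n)) (s≤s (s≤s (≤-pred (FP.toℕ<n i))))) onto
  where
    onto : ∀ {k} → Variant (2 + c) (suc c) k → ∃ λ (i : Fin (suc c)) → 2 + toℕ i ≡ k
    onto (headIsMax c≡M _)    = ⊥-elim (<-irrefl c≡M (n<1+n _))
    onto (oneAbove _ 2≤k k≤M) = fromMaxPosition 2≤k k≤M
    onto (twoAbove 2+c≡M _ _) = ⊥-elim (<-irrefl (sym (suc-injective 2+c≡M)) (n<1+n _))

HeadGap2-count : ∀ c → HasCard (HeadGap (2 + c) 2) c
HeadGap2-count zero    = HeadGap-empty ≤-refl
HeadGap2-count (suc c) = HeadGap-count refl (s≤s z≤n) (λ i → 2 + toℕ i) maxPosition-injective
  (λ i → twoAbove refl (s≤s (s≤s z≤n)) (s≤s (s≤s (s≤s (≤-pred (FP.toℕ<n i)))))) onto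
  where
    onto : ∀ {k} → Variant (3 + c) (suc c) k → ∃ λ (i : Fin (suc c)) → 2 + toℕ i ≡ k
    onto (headIsMax c≡M _)    = ⊥-elim (<-irrefl c≡M (≤-trans (n<1+n _) (n≤1+n _)))
    onto (oneAbove 1+c≡M _ _) = ⊥-elim (<-irrefl 1+c≡M (n<1+n _))
    onto (twoAbove _ 2≤k k<M) = fromMaxPosition 2≤k (≤-pred k<M)

HeadGap-unique : ∀ {M t t′} (π : Vec (Fin (suc M)) (suc M)) → HeadGap M t π → HeadGap M t′ π → t ≡ t′
HeadGap-unique π (_ , _ , t+c≡M) (_ , _ , t′+c≡M) = +-cancelʳ-≡ (entry π 0) _ _ (trans t+c≡M (sym t′+c≡M))

PositiveHead : ∀ {M} → Vec (Fin (suc M)) (suc M) → Set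
PositiveHead π = FishburnAvoiding π × 1 ≤ entry π 0

PositiveHead-count : ∀ m → HasCard (PositiveHead {suc m}) (1 + (m + (m ∸ 1)))
PositiveHead-count m = HasCard-⊎ (HeadGap0-count M (s≤s z≤n))
    (HasCard-⊎ (HeadGap1-count m) (gap2 m) (λ π g1 g2 → 0≢1+n (suc-injective (HeadGap-unique π g1 g2)))
      (λ _ g → g) (λ _ g → g))
    disjoint split merge
  where
    M = suc m
    gap2 : ∀ m → HasCard (HeadGap (suc m) 2) (m ∸ 1)
    gap2 zero    = HeadGap-empty (s≤s z≤n)
    gap2 (suc m) = HeadGap2-count m
    disjoint : ∀ π → HeadGap M 0 π → ¬ (HeadGap M 1 π ⊎ HeadGap M 2 π)
    disjoint π g0 (inj₁ g1) = 0≢1+n (HeadGap-unique π g0 g1)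
    disjoint π g0 (inj₂ g2) = 0≢1+n (HeadGap-unique π g0 g2)
    split : ∀ π → PositiveHead π → HeadGap M 0 π ⊎ (HeadGap M 1 π ⊎ HeadGap M 2 π)
    split π (fa , 1≤c) with familyPerm-complete π fa 1≤c
    ... | _ , headIsMax c≡M _ , _  = inj₁ (fa , 1≤c , c≡M)
    ... | _ , oneAbove 1+c≡M _ _ , _ = inj₂ (inj₁ (fa , 1≤c , 1+c≡M))
    ... | _ , twoAbove 2+c≡M _ _ , _ = inj₂ (inj₂ (fa , 1≤c , 2+c≡M))
    merge : ∀ π → HeadGap M 0 π ⊎ (HeadGap M 1 π ⊎ HeadGap M 2 π) → PositiveHead π
    merge π (inj₁ (fa , 1≤c , _))        = fa , 1≤c
    merge π (inj₂ (inj₁ (fa , 1≤c , _))) = fa , 1≤c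
    merge π (inj₂ (inj₂ (fa , 1≤c , _))) = fa , 1≤c

ZeroHead : ∀ {M} → Vec (Fin (suc M)) (suc M) → Set
ZeroHead π = FishburnAvoiding π × entry π 0 ≡ 0

ZeroHead-count : ∀ {n a} → HasCard (FishburnAvoiding {n}) a → HasCard (ZeroHead {n}) a
ZeroHead-count = HasCard-image prepend prepend-injective
  (λ σ fa → prepend-FishburnAvoiding σ fa , refl) (λ π (fa , π₀≡0) → unprepend π fa π₀≡0)

FishburnAvoiding-[] : FishburnAvoiding []
FishburnAvoiding-[] = On⇒FishburnAvoiding [] (mkFishburnAvoidingOn
  (λ _ _ ()) (λ _ _ _ ()) (λ _ _ _ _ _ ()) (λ _ _ _ _ _ _ _ ()))

-- classSize m is the size of the class in length m + 1.
classSize : ℕ → ℕ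
classSize zero    = 1
classSize (suc m) = classSize m + (1 + (m + (m ∸ 1)))

FishburnAvoiding-count : ∀ m → HasCard (FishburnAvoiding {suc m}) (classSize m)
FishburnAvoiding-count zero = (λ _ → prepend []) , (λ { fz fz _ → refl ; fz (fs ()) _ ; (fs ()) _ _ }) ,
  (λ _ → prepend-FishburnAvoiding [] FishburnAvoiding-[]) , λ { (fz ∷ []) _ → fz , refl }
FishburnAvoiding-count (suc m) =
  HasCard-⊎ (ZeroHead-count (FishburnAvoiding-count m)) (PositiveHead-count m) disjoint split merge
  where
    disjoint : ∀ π → ZeroHead π → ¬ PositiveHead π
    disjoint π (_ , π₀≡0) (_ , 1≤π₀) = <⇒≱ 1≤π₀ (≤-reflexive π₀≡0)
    split : ∀ π → FishburnAvoiding π → ZeroHead π ⊎ PositiveHead π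
    split π fa with entry π 0 ≟ 0
    ... | yes π₀≡0 = inj₁ (fa , π₀≡0)
    ... | no  π₀≢0 = inj₂ (fa , n≢0⇒n>0 π₀≢0)
    merge : ∀ π → ZeroHead π ⊎ PositiveHead π → FishburnAvoiding π
    merge π (inj₁ (fa , _)) = fa
    merge π (inj₂ (fa , _)) = fa

classSize-closed : ∀ m → classSize (suc m) ≡ m * m + m + 2
classSize-closed zero    = refl
classSize-closed (suc m) = trans (cong (_+ (1 + (suc m + m))) (classSize-closed m)) (step m)
  where
    step : ∀ x → x * x + x + 2 + (1 + (suc x + x)) ≡ suc x * suc x + suc x + 2
    step = solve-∀

quadratic-split : ∀ m → (2 + m) * (2 + m) + 4 ≡ (m * m + m + 2) + 3 * (2 + m)
quadratic-split = solve-∀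

theorem2p4 : ∀ (n : ℕ) → n ≥ 2 → HasCard (FishburnAvoiding {n}) (n * n + 4 ∸ 3 * n)
theorem2p4 (suc zero) (s≤s ())
theorem2p4 (suc (suc m)) _ = subst (HasCard FishburnAvoiding) (sym closed) (FishburnAvoiding-count (suc m))
  where
    open ≡-Reasoning
    closed : (2 + m) * (2 + m) + 4 ∸ 3 * (2 + m) ≡ classSize (suc m)
    closed = begin
      (2 + m) * (2 + m) + 4 ∸ 3 * (2 + m)          ≡⟨ cong (_∸ 3 * (2 + m)) (quadratic-split m) ⟩
      (m * m + m + 2) + 3 * (2 + m) ∸ 3 * (2 + m)  ≡⟨ m+n∸n≡m _ (3 * (2 + m)) ⟩
      m * m + m + 2                                ≡⟨ sym (classSize-closed m) ⟩
      classSize (suc m)                            ∎
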